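{- Let $N$ be a positive integer and let $\Pi=\bigcup_{1\le i<j\le 4}\bigcup_{ -N\le r\le N}\{(e_i,f_{ij}^r),(e_j,f_{ij}^r)\}\subset\mathbb R^4\times\mathbb R^{6(2N+1)}$, where $e_1,\dots,e_4$ is the standard basis of $\mathbb R^4$ and the symbols $f_{ij}^r$ (distinct $i,j\in[4]$, $-N\le r\le N$), identified via $f_{ij}^r=f_{ji}^{ -r}$, form the standard basis of $\mathbb R^{6(2N+1)}$. For distinct $i,j,k\in[4]$ and $-N\le r,s,t\le N$, let $X_{ijk}^{rst}$ be the circuit with affine dependence $(e_i,f_{ij}^r)-(e_j,f_{ij}^r)+(e_j,f_{jk}^s)-(e_k,f_{jk}^s)+(e_k,f_{ki}^t)-(e_i,f_{ki}^t)=0$, with positive part $(X_{ijk}^{rst})^+=\{(e_i,f_{ij}^r),(e_j,f_{jk}^s),(e_k,f_{ki}^t)\}$ and negative part $(X_{ijk}^{rst})^-$ the other three points, and let $\mathcal T_{ijk}^{rst}:=\{\sigma\subseteq X_{ijk}^{rst}:\sigma\not\supseteq(X_{ijk}^{rst})^+\}$. Let $\mathcal T$ be a triangulation of $\Pi$, and suppose there are distinct $i,j,k,l\in[4]$ and $1\le r,s,t,u,v,w\le N$ such that \[ \mathcal T_{ijl}^{rv(-u)},\ \mathcal T_{jkl}^{sw(-v)},\ \mathcal T_{kil}^{tu(-w)}\subseteq\mathcal T. \] Then $\mathcal T$ does not have a flip supported on $((X_{ijk}^{rst})^+,(X_{ijk}^{rst})^-)$.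
   Context: A triangulation of a finite point set $A$ is a collection of affinely independent subsets (simplices) of $A$, closed under faces, whose convex hulls cover $\mathrm{conv}(A)$ and intersect pairwise in convex hulls of common faces. For a circuit $X=(X^+,X^-)$ (minimal affinely dependent set split by signs of its affine dependence), $\mathcal T_X^{\pm}:=\{\sigma\subseteq X:\sigma\not\supseteq X^{\pm}\}$. The link of $C$ in $\mathcal T$ is $\{C'\in\mathcal T:C\cap C'=\emptyset,\ C\cup C'\in\mathcal T\}$. $\mathcal T$ has a flip supported on $(X^+,X^-)$ if $\mathcal T_X^+\subseteq\mathcal T$ and all maximal simplices of $\mathcal T_X^+$ have the same link in $\mathcal T$. -}

module Defs where

open import Data.Bool using (Bool; true; false; if_then_else_; _∨_; _∧_)
open import Data.Nat as ℕ using (ℕ; zero; suc)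
open import Data.Fin using (Fin; zero; suc; toℕ; remQuot)
open import Data.Fin.Subset using (Subset; _∈_; _∉_; _⊆_; _∩_; _∪_; ⊥; ⊤)
open import Data.Integer as ℤ using (ℤ; +_)
open import Data.Rational as ℚ using (ℚ; 0ℚ; 1ℚ)
open import Data.Product using (Σ; ∃; _×_; _,_)
open import Data.Sum using (_⊎_; inj₁; inj₂)
open import Data.List using (List; []; _∷_)
open import Data.Vec using (tabulate)
open import Relation.Nullary using (¬_; does)
open import Relation.Binary.PropositionalEquality using (_≡_)
open import Function using (_∘_)

sumℚ : ∀ {n} → (Fin n → ℚ) → ℚ
sumℚ {zero}  f = 0ℚ
sumℚ {suc n} f = f zero ℚ.+ sumℚ (f ∘ suc)

module Geometry {C : Set} {n : ℕ} (pos : Fin n → C → ℚ) where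

  SupportedOn : Subset n → (Fin n → ℚ) → Set
  SupportedOn σ λ′ = ∀ i → i ∉ σ → λ′ i ≡ 0ℚ

  AffinelyIndependent : Subset n → Set
  AffinelyIndependent σ =
    ∀ (λ′ : Fin n → ℚ) → SupportedOn σ λ′ →
      sumℚ λ′ ≡ 0ℚ →
      (∀ c → sumℚ (λ i → λ′ i ℚ.* pos i c) ≡ 0ℚ) →
      ∀ i → λ′ i ≡ 0ℚ

  InConv : Subset n → (C → ℚ) → Set
  InConv σ x = Σ (Fin n → ℚ) λ λ′ →
      (∀ i → 0ℚ ℚ.≤ λ′ i) × SupportedOn σ λ′ × (sumℚ λ′ ≡ 1ℚ) ×
      (∀ c → sumℚ (λ i → λ′ i ℚ.* pos i c) ≡ x c)

  record IsTriangulation (T : Subset n → Set) : Set where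
    field
      affInd   : ∀ σ → T σ → AffinelyIndependent σ
      faces    : ∀ σ τ → T σ → τ ⊆ σ → T τ
      covers   : ∀ x → InConv ⊤ x → ∃ λ σ → T σ × InConv σ x
      properIntersection : ∀ σ τ → T σ → T τ → ∀ x →
        InConv σ x → InConv τ x → InConv (σ ∩ τ) x

  InTXplus : Subset n → Subset n → Subset n → Set
  InTXplus Xp Xm σ = σ ⊆ (Xp ∪ Xm) × ¬ (Xp ⊆ σ)

  MaximalInTXplus : Subset n → Subset n → Subset n → Set
  MaximalInTXplus Xp Xm σ =
    InTXplus Xp Xm σ × (∀ τ → InTXplus Xp Xm τ → σ ⊆ τ → τ ≡ σ)

  InLink : (Subset n → Set) → Subset n → Subset n → Set
  InLink T σ C′ = T C′ × (σ ∩ C′ ≡ ⊥) × T (σ ∪ C′)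

  HasFlip : (Subset n → Set) → Subset n → Subset n → Set
  HasFlip T Xp Xm =
    (∀ σ → InTXplus Xp Xm σ → T σ) ×
    (∀ σ σ′ → MaximalInTXplus Xp Xm σ → MaximalInTXplus Xp Xm σ′ →
       ∀ C′ → InLink T σ C′ → InLink T σ′ C′)

-- number of values of r ∈ [-N, N]
K : ℕ → ℕ
K N = suc (2 ℕ.* N)

-- number of points of Π
M : ℕ → ℕ
M N = 12 ℕ.* K N

pair : Fin 12 → Fin 4 × Fin 4
pair zero = (zero , suc zero)
pair (suc zero) = (zero , suc (suc zero))
pair (suc (suc zero)) = (zero , suc (suc (suc zero)))
pair (suc (suc (suc zero))) = (suc zero , zero)
pair (suc (suc (suc (suc zero)))) = (suc zero , suc (suc zero))
pair (suc (suc (suc (suc (suc zero))))) = (suc zero , suc (suc (suc zero)))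
pair (suc (suc (suc (suc (suc (suc zero)))))) = (suc (suc zero) , zero)
pair (suc (suc (suc (suc (suc (suc (suc zero))))))) = (suc (suc zero) , suc zero)
pair (suc (suc (suc (suc (suc (suc (suc (suc zero)))))))) = (suc (suc zero) , suc (suc (suc zero)))
pair (suc (suc (suc (suc (suc (suc (suc (suc (suc zero))))))))) = (suc (suc (suc zero)) , zero)
pair (suc (suc (suc (suc (suc (suc (suc (suc (suc (suc zero)))))))))) = (suc (suc (suc zero)) , suc zero)
pair (suc (suc (suc (suc (suc (suc (suc (suc (suc (suc (suc zero))))))))))) = (suc (suc (suc zero)) , suc (suc zero))

-- A label (a , b , r) with a ≠ b and -N ≤ r ≤ N denotes the point (e_a , f_{ab}^r).
Label : Set
Label = Fin 4 × Fin 4 × ℤ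

label : (N : ℕ) → Fin (M N) → Label
label N p with remQuot {12} (K N) p
... | (q , x) with pair q
...   | (a , b) = (a , b , (+ toℕ x) ℤ.- (+ N))

_==F_ : Fin 4 → Fin 4 → Bool
a ==F b = does (a Data.Fin.≟ b)

_==L_ : Label → Label → Bool
(a , b , r) ==L (a′ , b′ , r′) = (a ==F a′) ∧ ((b ==F b′) ∧ does (r ℤ.≟ r′))

-- Coordinates: e_c for c ∈ [4], and the symbols f_{cd}^s.  The symbols
-- f_{cd}^s and f_{dc}^{-s} denote the same basis vector, so they carry the
-- same coordinate value (a duplicated coordinate; an injective linear
-- re-embedding that does not affect any affine notion).
Coord : Set
Coord = Fin 4 ⊎ Label

sameF : Label → Label → Bool
sameF (c , d , s) (a , b , r) =
  ((c , d , s) ==L (a , b , r)) ∨ ((c , d , s) ==L (b , a , ℤ.- r))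

indicator : Bool → ℚ
indicator true  = 1ℚ
indicator false = 0ℚ

posΠ : (N : ℕ) → Fin (M N) → Coord → ℚ
posΠ N p (inj₁ c) with label N p
... | (a , b , r) = indicator (c ==F a)
posΠ N p (inj₂ f) = indicator (sameF f (label N p))

module Π (N : ℕ) = Geometry (posΠ N)

points : (N : ℕ) → List Label → Subset (M N)
points N ls = tabulate λ p → anyL (label N p) ls
  where
    anyL : Label → List Label → Bool
    anyL x [] = false
    anyL x (y ∷ ys) = (x ==L y) ∨ anyL x ys

Xplus : (N : ℕ) → Fin 4 → Fin 4 → Fin 4 → ℤ → ℤ → ℤ → Subset (M N)
Xplus N i j k r s t = points N ((i , j , r) ∷ (j , k , s) ∷ (k , i , t) ∷ [])

-- (X_{ijk}^{rst})^- = {(e_j,f_ij^r),(e_k,f_jk^s),(e_i,f_ki^t)}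
--                   = {(e_j,f_ji^{-r}),(e_k,f_kj^{-s}),(e_i,f_ik^{-t})}
Xminus : (N : ℕ) → Fin 4 → Fin 4 → Fin 4 → ℤ → ℤ → ℤ → Subset (M N)
Xminus N i j k r s t =
  points N ((j , i , ℤ.- r) ∷ (k , j , ℤ.- s) ∷ (i , k , ℤ.- t) ∷ [])

TcircSub : (N : ℕ) → (Subset (M N) → Set) →
           Fin 4 → Fin 4 → Fin 4 → ℤ → ℤ → ℤ → Set
TcircSub N T i j k r s t =
  ∀ σ → Π.InTXplus N (Xplus N i j k r s t) (Xminus N i j k r s t) σ → T σ

FlipOn : (N : ℕ) → (Subset (M N) → Set) →
         Fin 4 → Fin 4 → Fin 4 → ℤ → ℤ → ℤ → Set
FlipOn N T i j k r s t =
  Π.HasFlip N T (Xplus N i j k r s t) (Xminus N i j k r s t)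

{-# OPTIONS --safe #-}
module Submission where

-- Twelve points of Π, one point (e_a , f_ab^ρ) for each oriented edge ab of the tetrahedron ijkl,
-- have a convex combination y whose barycentric coordinates m in a simplex σ of T containing y are
-- tightly constrained: they vanish off the twelve points (every other point owns an f-coordinate on
-- which y is 0) and satisfy nine linear equations, coming from the six f-coordinates f_ab and the
-- e-coordinates of i, j and l.  No simplex of T contains the positive part of a circuit whose
-- negative part lies in T, since both parts have the same barycentre and barycentric coordinates in
-- a triangulation are unique.  For X_ijk, X_jkl and X_kil this excludes supports of m; the equations
-- then force X_ijk ∖ {(e_i , f_ij^r)} into σ, and a flip on X_ijk would exchange σ for a simplex
-- containing the positive part of X_ijl.  These four exclusions leave the equations without
-- nonnegative solution.

open import Defs

open import Algebra.Bundles using (Ring)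
open import Data.Bool using (Bool; true; false; _∨_)
open import Data.Bool.Properties using (∨-comm)
open import Data.Empty using (⊥; ⊥-elim)
open import Data.Fin as Fin using (Fin; zero; suc; toℕ; combine; remQuot; fromℕ<)
open import Data.Fin.Properties using (all?; any?; combine-remQuot; remQuot-combine; toℕ-injective; toℕ-fromℕ<)
open import Data.Fin.Subset using (Subset; _∈_; _∉_; _⊆_; _∩_; _∪_; _─_; ⁅_⁆; ⊤)
open import Data.Fin.Subset.Properties
  using (_∈?_; ∈⊤; x∈p∪q⁺; x∈p∪q⁻; x∈p∩q⁻; p∩q⊆p; p∩q⊆q; p─q⊆p; p⊆p∪q; q⊆p∪q; x∈p∧x∉q⇒x∈p─q;
         x∈⁅x⁆; x∈⁅y⁆⇒x≡y; ⊆-antisym; Empty-unique)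
open import Data.Integer as ℤ using (ℤ; -[1+_]; ∣_∣)
import Data.Integer.Properties as ℤP
open import Data.List using (List; []; _∷_; filterᵇ)
open import Data.List.Membership.Propositional using () renaming (_∈_ to _∈ₗ_)
open import Data.List.Membership.Propositional.Properties using (∈-map⁺; ∈-map⁻)
open import Data.List.Relation.Unary.All as All using (All; []; _∷_)
open import Data.List.Relation.Unary.Any as Any using (here; there)
open import Data.Nat as ℕ using (ℕ; suc; s≤s; z≤n)
import Data.Nat.Properties as ℕP
open import Data.Product using (∃; _×_; _,_; proj₁; proj₂; uncurry)
open import Data.Product.Properties using (≡-dec)
open import Data.Rational as ℚ using (ℚ; 0ℚ; 1ℚ; _+_; _-_; _*_; _<_)
import Data.Rational.Properties as ℚP
open import Data.Rational.Solver using (module +-*-Solver)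
open import Data.Sum using (_⊎_; [_,_]′; inj₁; inj₂)
import Data.Vec as Vec
open import Data.Vec.Properties using (lookup∘tabulate; []=⇒lookup; lookup⇒[]=)
open import Function using (_∘_; id; case_of_)
open import Relation.Binary.Definitions using (DecidableEquality)
open import Relation.Binary.PropositionalEquality
open import Relation.Nullary using (¬_; ¬?; yes; no; does)
open import Relation.Nullary.Decidable
  using (False; toWitness; toWitnessFalse; from-yes; decidable-stable; dec-true; dec-false; map′; _×-dec_; _→-dec_)

open import Algebra.Properties.AbelianGroup ℤP.+-0-abelianGroup using () renaming (∙-cancelʳ to ℤ+-cancelʳ)
open import Algebra.Properties.Group ℚP.+-0-group using (x∙y⁻¹≈ε⇒x≈y)
open import Algebra.Properties.Semiring.Sum (Ring.semiring ℚP.+-*-ring)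
  using (sum; ∑-distrib-+; *-distribˡ-sum; sum-replicate-zero)

*-nonneg : ∀ {p q} → 0ℚ ℚ.≤ p → 0ℚ ℚ.≤ q → 0ℚ ℚ.≤ p * q
*-nonneg {p} {q} 0≤p 0≤q =
  subst (λ x → x ℚ.≤ p * q) (ℚP.*-zeroʳ p) (ℚP.*-monoˡ-≤-nonNeg p {{ℚ.nonNegative 0≤p}} 0≤q)

nonneg-+≡0⇒≡0 : ∀ {p q} → 0ℚ ℚ.≤ p → 0ℚ ℚ.≤ q → p + q ≡ 0ℚ → p ≡ 0ℚ
nonneg-+≡0⇒≡0 {p} {q} 0≤p 0≤q p+q≡0 =
  ℚP.≤-antisym (subst₂ ℚ._≤_ (ℚP.+-identityʳ p) p+q≡0 (ℚP.+-monoʳ-≤ p 0≤q)) 0≤p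

indicator-nonneg : ∀ b → 0ℚ ℚ.≤ indicator b
indicator-nonneg true  = ℚP.nonNegative⁻¹ 1ℚ
indicator-nonneg false = ℚP.≤-refl

excluded : ∀ {x y : ℚ} → (x ≢ 0ℚ → y ≢ 0ℚ → ⊥) → y ≢ 0ℚ → x ≡ 0ℚ
excluded {x} ¬both y≢0 = decidable-stable (x ℚP.≟ 0ℚ) (λ x≢0 → ¬both x≢0 y≢0)

complementˡ : ∀ {x y c} → x + y ≡ c → x ≡ 0ℚ → y ≡ c
complementˡ {x} {y} x+y≡c x≡0 = trans (sym (ℚP.+-identityˡ y)) (trans (cong (_+ y) (sym x≡0)) x+y≡c)

complementʳ : ∀ {x y c} → x + y ≡ c → y ≡ 0ℚ → x ≡ c
complementʳ {x} {y} x+y≡c y≡0 = complementˡ (trans (ℚP.+-comm y x) x+y≡c) y≡0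

nonneg-+-≢-neg : ∀ {c x y} → 0ℚ < c → 0ℚ ℚ.≤ x → 0ℚ ℚ.≤ y → x + y ≢ ℚ.- c
nonneg-+-≢-neg {c} 0<c x≥0 y≥0 x+y≡-c =
  ℚP.<-irrefl refl (ℚP.≤-<-trans (subst (0ℚ ℚ.≤_) x+y≡-c (ℚP.+-mono-≤ x≥0 y≥0)) (ℚP.neg-antimono-< 0<c))

pos-+-nonneg≢0 : ∀ {c x} → 0ℚ < c → 0ℚ ℚ.≤ x → c + x ≢ 0ℚ
pos-+-nonneg≢0 {c} {x} 0<c x≥0 c+x≡0 =
  ℚP.<-irrefl (sym c+x≡0)
    (ℚP.<-≤-trans 0<c (subst (λ y → y ℚ.≤ c + x) (ℚP.+-identityʳ c) (ℚP.+-monoʳ-≤ c x≥0)))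

thrice≡once⇒≡0 : ∀ {c} → c + (c + c) ≡ c → c ≡ 0ℚ
thrice≡once⇒≡0 {c} 3c≡c = begin
  c                          ≡⟨ solve 1 (λ c → c := con ½ :* ((c :+ (c :+ c)) :- c)) refl c ⟩
  ½ * ((c + (c + c)) - c)    ≡⟨ cong (λ x → ½ * (x - c)) 3c≡c ⟩
  ½ * (c - c)                ≡⟨ solve 1 (λ c → con ½ :* (c :- c) := con 0ℚ) refl c ⟩
  0ℚ                         ∎
  where
  open ≡-Reasoning
  open +-*-Solver
  ½ = ℤ.+ 1 ℚ./ 2

sumℚ≡sum : ∀ {n} (f : Fin n → ℚ) → sumℚ f ≡ sum f
sumℚ≡sum {ℕ.zero}  f = refl
sumℚ≡sum {ℕ.suc n} f = cong (f zero +_) (sumℚ≡sum (f ∘ suc))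

sumℚ-cong : ∀ {n} {f g : Fin n → ℚ} → (∀ i → f i ≡ g i) → sumℚ f ≡ sumℚ g
sumℚ-cong {ℕ.zero}  f≗g = refl
sumℚ-cong {ℕ.suc n} f≗g = cong₂ _+_ (f≗g zero) (sumℚ-cong (f≗g ∘ suc))

sumℚ-distrib-+ : ∀ {n} (f g : Fin n → ℚ) → sumℚ (λ i → f i + g i) ≡ sumℚ f + sumℚ g
sumℚ-distrib-+ f g = begin
  sumℚ (λ i → f i + g i) ≡⟨ sumℚ≡sum (λ i → f i + g i) ⟩
  sum (λ i → f i + g i)  ≡⟨ ∑-distrib-+ f g ⟩
  sum f + sum g          ≡⟨ sym (cong₂ _+_ (sumℚ≡sum f) (sumℚ≡sum g)) ⟩
  sumℚ f + sumℚ g        ∎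
  where open ≡-Reasoning

*-distribˡ-sumℚ : ∀ {n} c (f : Fin n → ℚ) → c * sumℚ f ≡ sumℚ (λ i → c * f i)
*-distribˡ-sumℚ c f = begin
  c * sumℚ f             ≡⟨ cong (c *_) (sumℚ≡sum f) ⟩
  c * sum f              ≡⟨ *-distribˡ-sum c f ⟩
  sum (λ i → c * f i)    ≡⟨ sym (sumℚ≡sum (λ i → c * f i)) ⟩
  sumℚ (λ i → c * f i)   ∎
  where open ≡-Reasoning

sumℚ-neg : ∀ {n} (f : Fin n → ℚ) → sumℚ (λ i → ℚ.- f i) ≡ ℚ.- sumℚ f
sumℚ-neg {ℕ.zero}  f = refl
sumℚ-neg {ℕ.suc n} f =
  trans (cong (ℚ.- f zero +_) (sumℚ-neg (f ∘ suc))) (sym (ℚP.neg-distrib-+ (f zero) (sumℚ (f ∘ suc))))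

sumℚ-distrib-- : ∀ {n} (f g : Fin n → ℚ) → sumℚ (λ i → f i - g i) ≡ sumℚ f - sumℚ g
sumℚ-distrib-- f g =
  trans (sumℚ-distrib-+ f (λ i → ℚ.- g i)) (cong (sumℚ f +_) (sumℚ-neg g))

sumℚ-nonneg : ∀ {n} {f : Fin n → ℚ} → (∀ i → 0ℚ ℚ.≤ f i) → 0ℚ ℚ.≤ sumℚ f
sumℚ-nonneg {ℕ.zero}  f≥0 = ℚP.≤-refl
sumℚ-nonneg {ℕ.suc n} f≥0 = ℚP.+-mono-≤ (f≥0 zero) (sumℚ-nonneg (f≥0 ∘ suc))

sumℚ-nonneg-≡0 : ∀ {n} {f : Fin n → ℚ} → (∀ i → 0ℚ ℚ.≤ f i) → sumℚ f ≡ 0ℚ → ∀ i → f i ≡ 0ℚ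
sumℚ-nonneg-≡0 f≥0 Σ≡0 zero =
  nonneg-+≡0⇒≡0 (f≥0 zero) (sumℚ-nonneg (f≥0 ∘ suc)) Σ≡0
sumℚ-nonneg-≡0 {f = f} f≥0 Σ≡0 (suc i) =
  sumℚ-nonneg-≡0 (f≥0 ∘ suc)
    (nonneg-+≡0⇒≡0 (sumℚ-nonneg (f≥0 ∘ suc)) (f≥0 zero) (trans (ℚP.+-comm _ (f zero)) Σ≡0)) i

sumℚ-zero : ∀ {n} → sumℚ {n} (λ _ → 0ℚ) ≡ 0ℚ
sumℚ-zero {n} = trans (sumℚ≡sum {n} (λ _ → 0ℚ)) (sum-replicate-zero n)

does-≟-injective : ∀ {A B : Set} (_≟A_ : DecidableEquality A) (_≟B_ : DecidableEquality B) {f : A → B} →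
                   (∀ {x y} → f x ≡ f y → x ≡ y) → ∀ x y → does (f x ≟B f y) ≡ does (x ≟A y)
does-≟-injective _≟A_ _≟B_ {f} f-injective x y with x ≟A y
... | yes refl = dec-true (f x ≟B f x) refl
... | no  x≢y  = dec-false (f x ≟B f y) (x≢y ∘ f-injective)

δ : ∀ {n} → Fin n → Fin n → ℚ
δ p i = indicator (does (p Fin.≟ i))

δ-self : ∀ {n} (p : Fin n) → δ p p ≡ 1ℚ
δ-self p = cong indicator (dec-true (p Fin.≟ p) refl)

δ-other : ∀ {n} {p i : Fin n} → p ≢ i → δ p i ≡ 0ℚ
δ-other {p = p} {i} p≢i = cong indicator (dec-false (p Fin.≟ i) p≢i)

δ-suc : ∀ {n} (p i : Fin n) → δ (suc p) (suc i) ≡ δ p i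
δ-suc p i with p Fin.≟ i
... | yes _ = refl
... | no  _ = refl

sumℚ-δ : ∀ {n} (p : Fin n) (g : Fin n → ℚ) → sumℚ (λ i → δ p i * g i) ≡ g p
sumℚ-δ {ℕ.suc n} zero g = begin
  1ℚ * g zero + sumℚ (λ i → 0ℚ * g (suc i))
    ≡⟨ cong₂ _+_ (ℚP.*-identityˡ (g zero)) (sumℚ-cong (ℚP.*-zeroˡ ∘ g ∘ suc)) ⟩
  g zero + sumℚ {n} (λ _ → 0ℚ)
    ≡⟨ cong (g zero +_) (sumℚ-zero {n}) ⟩
  g zero + 0ℚ
    ≡⟨ ℚP.+-identityʳ (g zero) ⟩
  g zero
    ∎
  where open ≡-Reasoning
sumℚ-δ (suc p) g = begin
  0ℚ * g zero + sumℚ (λ i → δ (suc p) (suc i) * g (suc i))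
    ≡⟨ cong₂ _+_ (ℚP.*-zeroˡ (g zero)) (sumℚ-cong (λ i → cong (_* g (suc i)) (δ-suc p i))) ⟩
  0ℚ + sumℚ (λ i → δ p i * g (suc i))
    ≡⟨ ℚP.+-identityˡ _ ⟩
  sumℚ (λ i → δ p i * g (suc i))
    ≡⟨ sumℚ-δ p (g ∘ suc) ⟩
  g (suc p)
    ∎
  where open ≡-Reasoning

sumL : {A : Set} → List A → (A → ℚ) → ℚ
sumL []       f = 0ℚ
sumL (p ∷ ps) f = f p + sumL ps f

module _ {A : Set} where

  sumL-cong : ∀ (ps : List A) {f g : A → ℚ} → (∀ p → f p ≡ g p) → sumL ps f ≡ sumL ps g
  sumL-cong []       f≗g = refl
  sumL-cong (p ∷ ps) f≗g = cong₂ _+_ (f≗g p) (sumL-cong ps f≗g)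

  sumL-nonneg : ∀ (ps : List A) {f : A → ℚ} → (∀ p → 0ℚ ℚ.≤ f p) → 0ℚ ℚ.≤ sumL ps f
  sumL-nonneg []       f≥0 = ℚP.≤-refl
  sumL-nonneg (p ∷ ps) f≥0 = ℚP.+-mono-≤ (f≥0 p) (sumL-nonneg ps f≥0)

  sumL-zero : ∀ {ps : List A} {f : A → ℚ} → All (λ p → f p ≡ 0ℚ) ps → sumL ps f ≡ 0ℚ
  sumL-zero []            = refl
  sumL-zero (f≡0 ∷ fs≡0) = trans (cong₂ _+_ f≡0 (sumL-zero fs≡0)) (ℚP.+-identityˡ 0ℚ)

  *-distribʳ-sumL : ∀ (ps : List A) (f : A → ℚ) c → sumL ps f * c ≡ sumL ps (λ p → f p * c)
  *-distribʳ-sumL []       f c = ℚP.*-zeroˡ c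
  *-distribʳ-sumL (p ∷ ps) f c =
    trans (ℚP.*-distribʳ-+ c (f p) (sumL ps f)) (cong (f p * c +_) (*-distribʳ-sumL ps f c))

  sumℚ-sumL : ∀ {n} (ps : List A) (F : A → Fin n → ℚ) →
              sumℚ (λ i → sumL ps (λ p → F p i)) ≡ sumL ps (λ p → sumℚ (F p))
  sumℚ-sumL {n} []       F = sumℚ-zero {n}
  sumℚ-sumL     (p ∷ ps) F =
    trans (sumℚ-distrib-+ (F p) (λ i → sumL ps (λ p → F p i))) (cong (sumℚ (F p) +_) (sumℚ-sumL ps F))

  sumL-indicator : ∀ (ps : List A) (b : A → Bool) (f : A → ℚ) →
                   sumL ps (λ p → f p * indicator (b p)) ≡ sumL (filterᵇ b ps) f
  sumL-indicator []       b f = refl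
  sumL-indicator (p ∷ ps) b f with b p
  ... | true  = cong₂ _+_ (ℚP.*-identityʳ (f p)) (sumL-indicator ps b f)
  ... | false = trans (cong₂ _+_ (ℚP.*-zeroʳ (f p)) (sumL-indicator ps b f)) (ℚP.+-identityˡ _)

module _ {A : Set} {n : ℕ} (P : A → Fin n) where

  combination : List A → (A → ℚ) → Fin n → ℚ
  combination ps w i = sumL ps (λ p → w p * δ (P p) i)

  sumℚ-combination : ∀ ps w (g : Fin n → ℚ) →
                     sumℚ (λ i → combination ps w i * g i) ≡ sumL ps (λ p → w p * g (P p))
  sumℚ-combination ps w g = begin
    sumℚ (λ i → combination ps w i * g i)
      ≡⟨ sumℚ-cong (λ i → trans (*-distribʳ-sumL ps (λ p → w p * δ (P p) i) (g i))
                                (sumL-cong ps (λ p → ℚP.*-assoc (w p) (δ (P p) i) (g i)))) ⟩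
    sumℚ (λ i → sumL ps (λ p → w p * (δ (P p) i * g i)))
      ≡⟨ sumℚ-sumL ps (λ p i → w p * (δ (P p) i * g i)) ⟩
    sumL ps (λ p → sumℚ (λ i → w p * (δ (P p) i * g i)))
      ≡⟨ sumL-cong ps (λ p → trans (sym (*-distribˡ-sumℚ (w p) (λ i → δ (P p) i * g i)))
                                   (cong (w p *_) (sumℚ-δ (P p) g))) ⟩
    sumL ps (λ p → w p * g (P p))
      ∎
    where open ≡-Reasoning

  combination-total : ∀ ps w → sumℚ (combination ps w) ≡ sumL ps w
  combination-total ps w =
    trans (sumℚ-cong (λ i → sym (ℚP.*-identityʳ (combination ps w i))))
          (trans (sumℚ-combination ps w (λ _ → 1ℚ)) (sumL-cong ps (ℚP.*-identityʳ ∘ w)))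

  combination-nonneg : ∀ ps {w} → (∀ p → 0ℚ ℚ.≤ w p) → ∀ i → 0ℚ ℚ.≤ combination ps w i
  combination-nonneg ps w≥0 i = sumL-nonneg ps (λ p → *-nonneg (w≥0 p) (indicator-nonneg (does (P p Fin.≟ i))))

  combination-outside : ∀ {ps} w {i} → All (λ p → P p ≢ i) ps → combination ps w i ≡ 0ℚ
  combination-outside w {i} = sumL-zero ∘ All.map (λ {p} Pp≢i → trans (cong (w p *_) (δ-other Pp≢i)) (ℚP.*-zeroʳ (w p)))

  combination-positive : ∀ {ps w q} → (∀ p → 0ℚ ℚ.≤ w p) → q ∈ₗ ps → 0ℚ < w q → 0ℚ < combination ps w (P q)
  combination-positive {p ∷ ps} {w} {q} w≥0 (here refl) 0<wq = begin-strict
    0ℚ                            <⟨ 0<wq ⟩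
    w q                           ≡⟨ sym (trans (cong (w q *_) (δ-self (P q))) (ℚP.*-identityʳ (w q))) ⟩
    w q * δ (P q) (P q)           ≡⟨ sym (ℚP.+-identityʳ _) ⟩
    w q * δ (P q) (P q) + 0ℚ      ≤⟨ ℚP.+-monoʳ-≤ (w q * δ (P q) (P q)) (combination-nonneg ps w≥0 (P q)) ⟩
    combination (p ∷ ps) w (P q)  ∎
    where open ℚP.≤-Reasoning
  combination-positive {p ∷ ps} {w} {q} w≥0 (there q∈ps) 0<wq = begin-strict
    0ℚ                            <⟨ combination-positive w≥0 q∈ps 0<wq ⟩
    combination ps w (P q)        ≡⟨ sym (ℚP.+-identityˡ _) ⟩
    0ℚ + combination ps w (P q)   ≤⟨ ℚP.+-monoˡ-≤ _ (*-nonneg (w≥0 p) (indicator-nonneg (does (P p Fin.≟ P q)))) ⟩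
    combination (p ∷ ps) w (P q)  ∎
    where open ℚP.≤-Reasoning

x∈p─q⇒x∉q : ∀ {n} {x : Fin n} {p q : Subset n} → x ∈ p ─ q → x ∉ q
x∈p─q⇒x∉q {p = _ Vec.∷ _} {q = _ Vec.∷ _} (Vec.there x∈p─q) (Vec.there x∈q) = x∈p─q⇒x∉q x∈p─q x∈q

module GeometryProperties {C : Set} {n : ℕ} (pos : Fin n → C → ℚ) where

  open Geometry pos
  open +-*-Solver

  affine-coefficients-unique :
    ∀ {σ λ₁ λ₂} → AffinelyIndependent σ → SupportedOn σ λ₁ → SupportedOn σ λ₂ →
    sumℚ λ₁ ≡ sumℚ λ₂ →
    (∀ c → sumℚ (λ i → λ₁ i * pos i c) ≡ sumℚ (λ i → λ₂ i * pos i c)) →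
    ∀ i → λ₁ i ≡ λ₂ i
  affine-coefficients-unique {σ} {λ₁} {λ₂} indep supp₁ supp₂ Σ₁≡Σ₂ moments₁≡moments₂ i =
    x∙y⁻¹≈ε⇒x≈y (λ₁ i) (λ₂ i) (indep (λ i → λ₁ i - λ₂ i) supp-diff Σ-diff moments-diff i)
    where
    open ≡-Reasoning
    supp-diff : SupportedOn σ (λ i → λ₁ i - λ₂ i)
    supp-diff i i∉σ = cong₂ _-_ (supp₁ i i∉σ) (supp₂ i i∉σ)
    Σ-diff : sumℚ (λ i → λ₁ i - λ₂ i) ≡ 0ℚ
    Σ-diff = begin
      sumℚ (λ i → λ₁ i - λ₂ i) ≡⟨ sumℚ-distrib-- λ₁ λ₂ ⟩
      sumℚ λ₁ - sumℚ λ₂        ≡⟨ cong (_- sumℚ λ₂) Σ₁≡Σ₂ ⟩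
      sumℚ λ₂ - sumℚ λ₂        ≡⟨ ℚP.+-inverseʳ (sumℚ λ₂) ⟩
      0ℚ                       ∎
    moments-diff : ∀ c → sumℚ (λ i → (λ₁ i - λ₂ i) * pos i c) ≡ 0ℚ
    moments-diff c = begin
      sumℚ (λ i → (λ₁ i - λ₂ i) * pos i c)
        ≡⟨ sumℚ-cong (λ i → solve 3 (λ a b x → (a :- b) :* x := a :* x :- b :* x) refl (λ₁ i) (λ₂ i) (pos i c)) ⟩
      sumℚ (λ i → λ₁ i * pos i c - λ₂ i * pos i c)
        ≡⟨ sumℚ-distrib-- (λ i → λ₁ i * pos i c) (λ i → λ₂ i * pos i c) ⟩
      sumℚ (λ i → λ₁ i * pos i c) - sumℚ (λ i → λ₂ i * pos i c)
        ≡⟨ cong (_- sumℚ (λ i → λ₂ i * pos i c)) (moments₁≡moments₂ c) ⟩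
      sumℚ (λ i → λ₂ i * pos i c) - sumℚ (λ i → λ₂ i * pos i c)
        ≡⟨ ℚP.+-inverseʳ (sumℚ (λ i → λ₂ i * pos i c)) ⟩
      0ℚ ∎

  InConv-resp : ∀ {σ x y} → (∀ c → x c ≡ y c) → InConv σ x → InConv σ y
  InConv-resp x≗y (λ′ , λ′≥0 , supp , Σλ′≡1 , moments) =
    λ′ , λ′≥0 , supp , Σλ′≡1 , (λ c → trans (moments c) (x≗y c))

  InConv-combination : ∀ {A : Set} (P : A → Fin n) ps {w σ} → (∀ p → 0ℚ ℚ.≤ w p) → sumL ps w ≡ 1ℚ →
                       All (λ p → P p ∈ σ) ps →
                       InConv σ (λ c → sumL ps (λ p → w p * pos (P p) c))
  InConv-combination P ps {w} {σ} w≥0 Σw≡1 ps⊆σ =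
    combination P ps w , combination-nonneg P ps w≥0 , supported ,
    trans (combination-total P ps w) Σw≡1 , (λ c → sumℚ-combination P ps w (λ i → pos i c))
    where
    supported : SupportedOn σ (combination P ps w)
    supported i i∉σ = combination-outside P w (All.map (λ Pp∈σ Pp≡i → i∉σ (subst (_∈ σ) Pp≡i Pp∈σ)) ps⊆σ)

  module _ {T : Subset n → Set} (triangulation : IsTriangulation T) where

    open IsTriangulation triangulation

    coefficients-vanish-outside : ∀ {σ τ x} → T σ → T τ → (x∈σ : InConv σ x) → InConv τ x →
                                  ∀ i → i ∉ τ → proj₁ x∈σ i ≡ 0ℚ
    coefficients-vanish-outside {σ} {τ} {x} Tσ Tτ x∈σ@(λ′ , _ , supp , Σλ′≡1 , moments) x∈τ i i∉τ =
      trans (affine-coefficients-unique (affInd σ Tσ) supp suppμ (trans Σλ′≡1 (sym Σμ≡1))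
                                        (λ c → trans (moments c) (sym (momentsμ c))) i)
            (suppμ∩ i (i∉τ ∘ p∩q⊆q σ τ))
      where
      x∈σ∩τ = properIntersection σ τ Tσ Tτ x x∈σ x∈τ
      μ = proj₁ x∈σ∩τ
      suppμ∩ = proj₁ (proj₂ (proj₂ x∈σ∩τ))
      Σμ≡1 = proj₁ (proj₂ (proj₂ (proj₂ x∈σ∩τ)))
      momentsμ = proj₂ (proj₂ (proj₂ (proj₂ x∈σ∩τ)))
      suppμ : SupportedOn σ μ
      suppμ i i∉σ = suppμ∩ i (i∉σ ∘ p∩q⊆p σ τ)

    -- The coordinates in σ of the common barycentre are positive at x₁ and vanish outside τ.
    common-barycentre⇒∈ : ∀ {σ τ x₁ x₂ x₃ y₁ y₂ y₃} → T σ → T τ →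
      x₁ ∈ σ → x₂ ∈ σ → x₃ ∈ σ → y₁ ∈ τ → y₂ ∈ τ → y₃ ∈ τ →
      (∀ c → pos x₁ c + (pos x₂ c + pos x₃ c) ≡ pos y₁ c + (pos y₂ c + pos y₃ c)) →
      x₁ ∈ τ
    common-barycentre⇒∈ {σ} {τ} {x₁} {x₂} {x₃} {y₁} {y₂} {y₃} Tσ Tτ x₁∈σ x₂∈σ x₃∈σ y₁∈τ y₂∈τ y₃∈τ same =
      decidable-stable (x₁ ∈? τ) λ x₁∉τ →
        ℚP.<⇒≢ (combination-positive id {xs} {λ _ → ⅓} {x₁} ⅓≥0 (here refl) (ℚP.positive⁻¹ ⅓))
               (sym (coefficients-vanish-outside Tσ Tτ barycentre∈σ barycentre∈τ x₁ x₁∉τ))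
      where
      xs = x₁ ∷ x₂ ∷ x₃ ∷ []
      ⅓ : ℚ
      ⅓ = ℤ.+ 1 ℚ./ 3
      ⅓≥0 : Fin n → 0ℚ ℚ.≤ ⅓
      ⅓≥0 _ = ℚP.nonNegative⁻¹ ⅓
      barycentre : ∀ z₁ z₂ z₃ c →
                   sumL (z₁ ∷ z₂ ∷ z₃ ∷ []) (λ z → ⅓ * pos z c) ≡ ⅓ * (pos z₁ c + (pos z₂ c + pos z₃ c))
      barycentre z₁ z₂ z₃ c =
        solve 3 (λ a b d → con ⅓ :* a :+ (con ⅓ :* b :+ (con ⅓ :* d :+ con 0ℚ)) := con ⅓ :* (a :+ (b :+ d)))
              refl (pos z₁ c) (pos z₂ c) (pos z₃ c)
      same-barycentre : ∀ c → sumL (y₁ ∷ y₂ ∷ y₃ ∷ []) (λ z → ⅓ * pos z c) ≡ sumL xs (λ z → ⅓ * pos z c)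
      same-barycentre c =
        trans (barycentre y₁ y₂ y₃ c) (trans (cong (⅓ *_) (sym (same c))) (sym (barycentre x₁ x₂ x₃ c)))
      barycentre∈σ = InConv-combination id xs ⅓≥0 refl (x₁∈σ ∷ x₂∈σ ∷ x₃∈σ ∷ [])
      barycentre∈τ = InConv-resp same-barycentre
                       (InConv-combination id (y₁ ∷ y₂ ∷ y₃ ∷ []) ⅓≥0 refl (y₁∈τ ∷ y₂∈τ ∷ y₃∈τ ∷ []))

  module _ (Xp Xm : Subset n) where

    private X = Xp ∪ Xm

    X─e-maximal : ∀ {e} → e ∈ Xp → MaximalInTXplus Xp Xm (X ─ ⁅ e ⁆)
    X─e-maximal {e} e∈Xp =
      (p─q⊆p X ⁅ e ⁆ , λ Xp⊆X─e → x∈p─q⇒x∉q (Xp⊆X─e e∈Xp) (x∈⁅x⁆ e)) , maximal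
      where
      maximal : ∀ τ → InTXplus Xp Xm τ → X ─ ⁅ e ⁆ ⊆ τ → τ ≡ X ─ ⁅ e ⁆
      maximal τ (τ⊆X , Xp⊈τ) X─e⊆τ = ⊆-antisym τ⊆X─e X─e⊆τ
        where
        Xp⊆τ : ∀ {z} → z ∈ τ → z ≡ e → Xp ⊆ τ
        Xp⊆τ {z} z∈τ z≡e {y} y∈Xp with y Fin.≟ e
        ... | yes y≡e = subst (_∈ τ) (trans z≡e (sym y≡e)) z∈τ
        ... | no  y≢e = X─e⊆τ (x∈p∧x∉q⇒x∈p─q (p⊆p∪q Xm y∈Xp) (y≢e ∘ x∈⁅y⁆⇒x≡y e))
        τ⊆X─e : τ ⊆ X ─ ⁅ e ⁆
        τ⊆X─e z∈τ = x∈p∧x∉q⇒x∈p─q (τ⊆X z∈τ) (λ z∈⁅e⁆ → Xp⊈τ (Xp⊆τ z∈τ (x∈⁅y⁆⇒x≡y e z∈⁅e⁆)))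

    module _ {T : Subset n → Set} (triangulation : IsTriangulation T) where

      open IsTriangulation triangulation

      -- σ ─ X lies in the link of X ─ {e}, hence in that of X ─ {e′}.
      flip-exchange : HasFlip T Xp Xm → ∀ {σ e e′} → T σ → e ∈ Xp → e′ ∈ Xp →
                      X ─ ⁅ e ⁆ ⊆ σ → T ((X ─ ⁅ e′ ⁆) ∪ (σ ─ X))
      flip-exchange (_ , same-link) {σ} {e} Tσ e∈Xp e′∈Xp X─e⊆σ =
        proj₂ (proj₂ (same-link _ _ (X─e-maximal e∈Xp) (X─e-maximal e′∈Xp) (σ ─ X) link))
        where
        disjoint : ∀ {z} → z ∈ (X ─ ⁅ e ⁆) ∩ (σ ─ X) → ⊥
        disjoint z∈ = let z∈X─e , z∈σ─X = x∈p∩q⁻ (X ─ ⁅ e ⁆) (σ ─ X) z∈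
                      in x∈p─q⇒x∉q z∈σ─X (p─q⊆p X ⁅ e ⁆ z∈X─e)
        link : InLink T (X ─ ⁅ e ⁆) (σ ─ X)
        link = faces σ (σ ─ X) Tσ (p─q⊆p σ X) ,
               Empty-unique (disjoint ∘ proj₂) ,
               faces σ _ Tσ ([ X─e⊆σ , p─q⊆p σ X ]′ ∘ x∈p∪q⁻ (X ─ ⁅ e ⁆) (σ ─ X))

      negative-part-∈ : (∀ σ → InTXplus Xp Xm σ → T σ) → ∀ {e} → e ∈ Xp → e ∉ Xm → T Xm
      negative-part-∈ 𝒯⁺⊆T e∈Xp e∉Xm = 𝒯⁺⊆T Xm (q⊆p∪q Xp Xm , λ Xp⊆Xm → e∉Xm (Xp⊆Xm e∈Xp))

-- Written out so that `does (x ≟L y)` is definitionally `x ==L y`, the test used by `points` and `posΠ`.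
_≟L_ : DecidableEquality Label
(a , b , z) ≟L (a′ , b′ , z′) =
  map′ (λ (a≡a′ , b≡b′ , z≡z′) → cong₂ _,_ a≡a′ (cong₂ _,_ b≡b′ z≡z′)) (λ { refl → refl , refl , refl })
       (a Fin.≟ a′ ×-dec b Fin.≟ b′ ×-dec z ℤ.≟ z′)

dualL : Label → Label
dualL (a , b , z) = b , a , ℤ.- z

sameF-dualL : ∀ f x → sameF f (dualL x) ≡ sameF f x
sameF-dualL f (a , b , z) rewrite ℤP.neg-involutive z = ∨-comm (f ==L (b , a , ℤ.- z)) (f ==L (a , b , z))

private
  _≟²_ : DecidableEquality (Fin 4 × Fin 4)
  _≟²_ = ≡-dec Fin._≟_ Fin._≟_

pair-injective : ∀ q q′ → pair q ≡ pair q′ → q ≡ q′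
pair-injective = toWitness {a? = all? λ q → all? λ q′ → (pair q ≟² pair q′) →-dec (q Fin.≟ q′)} _

pair-surjective : ∀ a b → a ≢ b → ∃ λ q → pair q ≡ (a , b)
pair-surjective = toWitness {a? = all? λ a → all? λ b → ¬? (a Fin.≟ b) →-dec any? λ q → pair q ≟² (a , b)} _

module ΠProperties (N : ℕ) where

  offset : Fin (K N) → ℤ
  offset x = ℤ.+ toℕ x ℤ.- ℤ.+ N

  offset-injective : ∀ {x x′} → offset x ≡ offset x′ → x ≡ x′
  offset-injective {x} {x′} eq =
    toℕ-injective (ℤP.+-injective (ℤ+-cancelʳ (ℤ.- ℤ.+ N) (ℤ.+ toℕ x) (ℤ.+ toℕ x′) eq))

  offset-surjective : ∀ z → ∣ z ∣ ℕ.≤ N → ∃ λ x → offset x ≡ z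
  offset-surjective (ℤ.+ n) n≤N = fromℕ< N+n<K , (begin
    ℤ.+ toℕ (fromℕ< N+n<K) ℤ.- ℤ.+ N ≡⟨ cong (λ m → ℤ.+ m ℤ.- ℤ.+ N) (toℕ-fromℕ< N+n<K) ⟩
    ℤ.+ (N ℕ.+ n) ℤ.- ℤ.+ N        ≡⟨ ℤP.[+m]-[+n]≡m⊖n (N ℕ.+ n) N ⟩
    (N ℕ.+ n) ℤ.⊖ N              ≡⟨ ℤP.⊖-≥ (ℕP.m≤m+n N n) ⟩
    ℤ.+ (N ℕ.+ n ℕ.∸ N)            ≡⟨ cong ℤ.+_ (ℕP.m+n∸m≡n N n) ⟩
    ℤ.+ n                        ∎)
    where
    open ≡-Reasoning
    N+n<K : N ℕ.+ n ℕ.< K N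
    N+n<K = s≤s (ℕP.+-monoʳ-≤ N (subst (n ℕ.≤_) (sym (ℕP.+-identityʳ N)) n≤N))
  offset-surjective -[1+ n ] n<N = fromℕ< N∸n<K , (begin
    ℤ.+ toℕ (fromℕ< N∸n<K) ℤ.- ℤ.+ N ≡⟨ cong (λ m → ℤ.+ m ℤ.- ℤ.+ N) (toℕ-fromℕ< N∸n<K) ⟩
    ℤ.+ (N ℕ.∸ suc n) ℤ.- ℤ.+ N    ≡⟨ ℤP.[+m]-[+n]≡m⊖n (N ℕ.∸ suc n) N ⟩
    (N ℕ.∸ suc n) ℤ.⊖ N          ≡⟨ ℤP.⊖-≤ (ℕP.m∸n≤m N (suc n)) ⟩
    ℤ.- ℤ.+ (N ℕ.∸ (N ℕ.∸ suc n))  ≡⟨ cong (ℤ.-_ ∘ ℤ.+_) (ℕP.m∸[m∸n]≡n n<N) ⟩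
    -[1+ n ]                     ∎)
    where
    open ≡-Reasoning
    N∸n<K : N ℕ.∸ suc n ℕ.< K N
    N∸n<K = s≤s (ℕP.≤-trans (ℕP.m∸n≤m N (suc n)) (ℕP.m≤m+n N (N ℕ.+ 0)))

  labelOf : Fin 12 × Fin (K N) → Label
  labelOf (q , x) = proj₁ (pair q) , proj₂ (pair q) , offset x

  label≡labelOf : ∀ p → label N p ≡ labelOf (remQuot {12} (K N) p)
  label≡labelOf p = refl

  label-combine : ∀ q x → label N (combine q x) ≡ labelOf (q , x)
  label-combine q x = cong labelOf (remQuot-combine q x)

  labelOf-injective : ∀ {qx qx′} → labelOf qx ≡ labelOf qx′ → qx ≡ qx′
  labelOf-injective {q , x} {q′ , x′} eq =
    cong₂ _,_ (pair-injective q q′ (cong (λ (a , b , _) → a , b) eq)) (offset-injective (cong (proj₂ ∘ proj₂) eq))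

  label-injective : ∀ {p p′} → label N p ≡ label N p′ → p ≡ p′
  label-injective {p} {p′} eq = begin
    p                    ≡⟨ sym (combine-remQuot {12} (K N) p) ⟩
    uncurry combine qx   ≡⟨ cong (uncurry combine) (labelOf-injective {qx} {qx′} labelOf-qx≡labelOf-qx′) ⟩
    uncurry combine qx′  ≡⟨ combine-remQuot {12} (K N) p′ ⟩
    p′                   ∎
    where
    open ≡-Reasoning
    qx  = remQuot {12} (K N) p
    qx′ = remQuot {12} (K N) p′
    labelOf-qx≡labelOf-qx′ = trans (sym (label≡labelOf p)) (trans eq (label≡labelOf p′))

  label-surjective : ∀ {a b z} → a ≢ b → ∣ z ∣ ℕ.≤ N → ∃ λ p → label N p ≡ (a , b , z)
  label-surjective {a} {b} {z} a≢b ∣z∣≤N =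
    combine q x , trans (label-combine q x) (cong₂ (λ (a , b) z → a , b , z) pair-q≡ab offset-x≡z)
    where
    q = proj₁ (pair-surjective a b a≢b)
    pair-q≡ab = proj₂ (pair-surjective a b a≢b)
    x = proj₁ (offset-surjective z ∣z∣≤N)
    offset-x≡z = proj₂ (offset-surjective z ∣z∣≤N)

  open import Data.List.Membership.DecPropositional _≟L_ using () renaming (_∈?_ to _∈ₗ?_)

  -- `points` tests membership with a function local to its definition, so this only holds by
  -- computation for lists of a fixed shape.
  lookup-points₃ : ∀ a b c z → Vec.lookup (points N (a ∷ b ∷ c ∷ [])) z ≡ does (label N z ∈ₗ? (a ∷ b ∷ c ∷ []))
  lookup-points₃ a b c = lookup∘tabulate (λ z → does (label N z ∈ₗ? (a ∷ b ∷ c ∷ [])))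

  ∈-points₃⁻ : ∀ {a b c z} → z ∈ points N (a ∷ b ∷ c ∷ []) → label N z ∈ₗ (a ∷ b ∷ c ∷ [])
  ∈-points₃⁻ {a} {b} {c} {z} z∈ = decidable-stable (label N z ∈ₗ? (a ∷ b ∷ c ∷ [])) λ lz∉ →
    case trans (sym ([]=⇒lookup z∈)) (trans (lookup-points₃ a b c z) (dec-false (label N z ∈ₗ? _) lz∉)) of λ ()

  ∈-points₃⁺ : ∀ {a b c z} → label N z ∈ₗ (a ∷ b ∷ c ∷ []) → z ∈ points N (a ∷ b ∷ c ∷ [])
  ∈-points₃⁺ {a} {b} {c} {z} lz∈ = lookup⇒[]= z _ (trans (lookup-points₃ a b c z) (dec-true (label N z ∈ₗ? _) lz∈))

  posΠ-own-f : ∀ x → posΠ N x (inj₂ (label N x)) ≡ 1ℚ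
  posΠ-own-f x = cong (λ b → indicator (b ∨ (label N x ==L dualL (label N x)))) (dec-true (label N x ≟L label N x) refl)

  posΠ-nonneg : ∀ p c → 0ℚ ℚ.≤ posΠ N p c
  posΠ-nonneg p (inj₁ c) = indicator-nonneg (c ==F proj₁ (label N p))
  posΠ-nonneg p (inj₂ f) = indicator-nonneg (sameF f (label N p))

data Vertex : Set where
  vᵢ vⱼ vₖ vₗ : Vertex

_≟V_ : DecidableEquality Vertex
vᵢ ≟V vᵢ = yes refl
vᵢ ≟V vⱼ = no λ ()
vᵢ ≟V vₖ = no λ ()
vᵢ ≟V vₗ = no λ ()
vⱼ ≟V vᵢ = no λ ()
vⱼ ≟V vⱼ = yes refl
vⱼ ≟V vₖ = no λ ()
vⱼ ≟V vₗ = no λ ()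
vₖ ≟V vᵢ = no λ ()
vₖ ≟V vⱼ = no λ ()
vₖ ≟V vₖ = yes refl
vₖ ≟V vₗ = no λ ()
vₗ ≟V vᵢ = no λ ()
vₗ ≟V vⱼ = no λ ()
vₗ ≟V vₖ = no λ ()
vₗ ≟V vₗ = yes refl

-- ab names the point (e_a , f_ab^ρ) of Π, with ρ = `Tetrahedron.level ab`; since f_ab^ρ = f_ba^-ρ,
-- ab and its opposite ba share their f-coordinate.
data NamedPoint : Set where
  ij ji jk kj ki ik jl lj kl lk il li : NamedPoint

src dst : NamedPoint → Vertex
src ij = vᵢ
src ji = vⱼ
src jk = vⱼ
src kj = vₖ
src ki = vₖ
src ik = vᵢ
src jl = vⱼ
src lj = vₗ
src kl = vₖ
src lk = vₗ
src il = vᵢ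
src li = vₗ
dst ij = vⱼ
dst ji = vᵢ
dst jk = vₖ
dst kj = vⱼ
dst ki = vᵢ
dst ik = vₖ
dst jl = vₗ
dst lj = vⱼ
dst kl = vₗ
dst lk = vₖ
dst il = vₗ
dst li = vᵢ

edge : Vertex → Vertex → NamedPoint
edge vᵢ vⱼ = ij
edge vⱼ vᵢ = ji
edge vⱼ vₖ = jk
edge vₖ vⱼ = kj
edge vₖ vᵢ = ki
edge vᵢ vₖ = ik
edge vⱼ vₗ = jl
edge vₗ vⱼ = lj
edge vₖ vₗ = kl
edge vₗ vₖ = lk
edge vᵢ vₗ = il
edge vₗ vᵢ = li
edge _  _  = ij  -- junk on the diagonal

edge-src-dst : ∀ p → edge (src p) (dst p) ≡ p
edge-src-dst ij = refl
edge-src-dst ji = refl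
edge-src-dst jk = refl
edge-src-dst kj = refl
edge-src-dst ki = refl
edge-src-dst ik = refl
edge-src-dst jl = refl
edge-src-dst lj = refl
edge-src-dst kl = refl
edge-src-dst lk = refl
edge-src-dst il = refl
edge-src-dst li = refl

src-dst-injective : ∀ {p q} → src p ≡ src q → dst p ≡ dst q → p ≡ q
src-dst-injective {p} {q} src≡ dst≡ = trans (sym (edge-src-dst p)) (trans (cong₂ edge src≡ dst≡) (edge-src-dst q))

_≟ₚ_ : DecidableEquality NamedPoint
p ≟ₚ q = map′ (uncurry src-dst-injective) (λ { refl → refl , refl }) (src p ≟V src q ×-dec dst p ≟V dst q)

src≢dst : ∀ p → src p ≢ dst p
src≢dst ij ()
src≢dst ji ()
src≢dst jk ()
src≢dst kj ()
src≢dst ki ()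
src≢dst ik ()
src≢dst jl ()
src≢dst lj ()
src≢dst kl ()
src≢dst lk ()
src≢dst il ()
src≢dst li ()

opposite : NamedPoint → NamedPoint
opposite p = edge (dst p) (src p)

src-opposite : ∀ p → src (opposite p) ≡ dst p
src-opposite ij = refl
src-opposite ji = refl
src-opposite jk = refl
src-opposite kj = refl
src-opposite ki = refl
src-opposite ik = refl
src-opposite jl = refl
src-opposite lj = refl
src-opposite kl = refl
src-opposite lk = refl
src-opposite il = refl
src-opposite li = refl

allPoints : List NamedPoint
allPoints = ij ∷ ji ∷ jk ∷ kj ∷ ki ∷ ik ∷ jl ∷ lj ∷ kl ∷ lk ∷ il ∷ li ∷ []

∈-allPoints : ∀ p → p ∈ₗ allPoints
∈-allPoints ij = here refl
∈-allPoints ji = there (here refl)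
∈-allPoints jk = there (there (here refl))
∈-allPoints kj = there (there (there (here refl)))
∈-allPoints ki = there (there (there (there (here refl))))
∈-allPoints ik = there (there (there (there (there (here refl)))))
∈-allPoints jl = there (there (there (there (there (there (here refl))))))
∈-allPoints lj = there (there (there (there (there (there (there (here refl)))))))
∈-allPoints kl = there (there (there (there (there (there (there (there (here refl))))))))
∈-allPoints lk = there (there (there (there (there (there (there (there (there (here refl)))))))))
∈-allPoints il = there (there (there (there (there (there (there (there (there (there (here refl))))))))))
∈-allPoints li = there (there (there (there (there (there (there (there (there (there (there (here refl)))))))))))

filter-≟ₚ-allPoints : ∀ q → filterᵇ (λ p → does (p ≟ₚ q)) allPoints ≡ q ∷ []
filter-≟ₚ-allPoints ij = refl
filter-≟ₚ-allPoints ji = refl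
filter-≟ₚ-allPoints jk = refl
filter-≟ₚ-allPoints kj = refl
filter-≟ₚ-allPoints ki = refl
filter-≟ₚ-allPoints ik = refl
filter-≟ₚ-allPoints jl = refl
filter-≟ₚ-allPoints lj = refl
filter-≟ₚ-allPoints kl = refl
filter-≟ₚ-allPoints lk = refl
filter-≟ₚ-allPoints il = refl
filter-≟ₚ-allPoints li = refl

zone : NamedPoint → List NamedPoint
zone p = filterᵇ (λ q → does (p ≟ₚ q) ∨ does (p ≟ₚ opposite q)) allPoints

star : Vertex → List NamedPoint
star a = filterᵇ (λ q → does (a ≟V src q)) allPoints

ε : ℚ
ε = ℤ.+ 1 ℚ./ 10

-- The weights of y.  With the exclusion for X_ijk, the equations they induce force every
-- nonnegative solution to be nonzero on X_ijk ∖ {ij} (see `X∖ij-supported`).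
ω : NamedPoint → ℚ
ω ij = 0ℚ
ω ji = ε
ω jk = ε + ε
ω kj = ε
ω ki = ε + ε
ω ik = ε
ω jl = 0ℚ
ω lj = ε
ω kl = ε
ω lk = 0ℚ
ω il = ε
ω li = 0ℚ

ω-nonneg : ∀ p → 0ℚ ℚ.≤ ω p
ω-nonneg p = All.lookup (from-yes (All.all? (λ p → 0ℚ ℚP.≤? ω p) allPoints)) (∈-allPoints p)

sumL-ω : sumL allPoints ω ≡ 1ℚ
sumL-ω = refl

cyclic-exclusion : ∀ {c d₁ d₂ e₁ e₂ f₁ f₂ : ℚ} → c ≢ 0ℚ →
  d₁ + d₂ ≡ c → e₁ + e₂ ≡ c → f₁ + f₂ ≡ c → d₂ + (e₂ + f₂) ≡ c →
  (d₁ ≢ 0ℚ → f₂ ≢ 0ℚ → ⊥) → (e₁ ≢ 0ℚ → d₂ ≢ 0ℚ → ⊥) → (f₁ ≢ 0ℚ → e₂ ≢ 0ℚ → ⊥) → ⊥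
cyclic-exclusion {c} {d₁} c≢0 d e f d₂+e₂+f₂≡c ¬d₁f₂ ¬e₁d₂ ¬f₁e₂ with d₁ ℚP.≟ 0ℚ
... | yes d₁≡0 =
  c≢0 (thrice≡once⇒≡0 (subst (λ x → x ≡ c) (cong₂ _+_ d₂≡c (cong₂ _+_ e₂≡c f₂≡c)) d₂+e₂+f₂≡c))
  where
  d₂≡c = complementˡ d d₁≡0
  e₂≡c = complementˡ e (excluded ¬e₁d₂ (λ d₂≡0 → c≢0 (trans (sym d₂≡c) d₂≡0)))
  f₂≡c = complementˡ f (excluded ¬f₁e₂ (λ e₂≡0 → c≢0 (trans (sym e₂≡c) e₂≡0)))
... | no d₁≢0 = c≢0 (trans (sym d₂+e₂+f₂≡c) (trans (cong₂ _+_ d₂≡0 (cong₂ _+_ e₂≡0 f₂≡0)) refl))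
  where
  f₂≡0 = excluded (λ f₂≢0 _ → ¬d₁f₂ d₁≢0 f₂≢0) d₁≢0
  e₂≡0 = excluded (λ e₂≢0 f₁≢0 → ¬f₁e₂ f₁≢0 e₂≢0) (λ f₁≡0 → c≢0 (trans (sym (complementʳ f f₂≡0)) f₁≡0))
  d₂≡0 = excluded (λ d₂≢0 e₁≢0 → ¬e₁d₂ e₁≢0 d₂≢0) (λ e₁≡0 → c≢0 (trans (sym (complementʳ e e₂≡0)) e₁≡0))

module Infeasibility (m : NamedPoint → ℚ) (m≥0 : ∀ p → 0ℚ ℚ.≤ m p)
                     (zone-sums : ∀ p → sumL (zone p) m ≡ sumL (zone p) ω)
                     (star-sums : ∀ a → sumL (star a) m ≡ sumL (star a) ω) where

  open +-*-Solver
  open ≡-Reasoning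

  private
    ε>0 : 0ℚ < ε
    ε>0 = ℚP.positive⁻¹ ε

    sumL₂ : ∀ a b → sumL (a ∷ b ∷ []) m ≡ m a + m b
    sumL₂ a b = cong (m a +_) (ℚP.+-identityʳ (m b))

    sumL₃ : ∀ a b c → sumL (a ∷ b ∷ c ∷ []) m ≡ m a + (m b + m c)
    sumL₃ a b c = cong (λ x → m a + (m b + x)) (ℚP.+-identityʳ (m c))

    ij-zone : m ij + m ji ≡ ε
    ij-zone = trans (sym (sumL₂ ij ji)) (zone-sums ij)
    jk-zone : m jk + m kj ≡ ε + (ε + ε)
    jk-zone = trans (sym (sumL₂ jk kj)) (zone-sums jk)
    ki-zone : m ki + m ik ≡ ε + (ε + ε)
    ki-zone = trans (sym (sumL₂ ki ik)) (zone-sums ki)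
    jl-zone : m jl + m lj ≡ ε
    jl-zone = trans (sym (sumL₂ jl lj)) (zone-sums jl)
    kl-zone : m kl + m lk ≡ ε
    kl-zone = trans (sym (sumL₂ kl lk)) (zone-sums kl)
    il-zone : m il + m li ≡ ε
    il-zone = trans (sym (sumL₂ il li)) (zone-sums il)
    i-star : m ij + (m ik + m il) ≡ ε + ε
    i-star = trans (sym (sumL₃ ij ik il)) (star-sums vᵢ)
    j-star : m ji + (m jk + m jl) ≡ ε + (ε + ε)
    j-star = trans (sym (sumL₃ ji jk jl)) (star-sums vⱼ)
    l-star : m lj + (m lk + m li) ≡ ε
    l-star = trans (sym (sumL₃ lj lk li)) (star-sums vₗ)

    ki≢0 : m ki ≢ 0ℚ
    ki≢0 ki≡0 = nonneg-+-≢-neg ε>0 (m≥0 ij) (m≥0 il) (begin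
      m ij + m il
        ≡⟨ solve 4 (λ a b c d → a :+ d := (a :+ (c :+ d)) :- (b :+ c) :+ b) refl (m ij) (m ki) (m ik) (m il) ⟩
      (m ij + (m ik + m il)) - (m ki + m ik) + m ki
        ≡⟨ cong₂ (λ x y → x - y + m ki) i-star ki-zone ⟩
      (ε + ε) - (ε + (ε + ε)) + m ki
        ≡⟨ cong ((ε + ε) - (ε + (ε + ε)) +_) ki≡0 ⟩
      ℚ.- ε
        ∎)

    jk≢0 : m jk ≢ 0ℚ
    jk≢0 jk≡0 = nonneg-+-≢-neg ε>0 (m≥0 ij) (m≥0 lj) (begin
      m ij + m lj
        ≡⟨ solve 5 (λ a b c d e → a :+ e := (a :+ b) :+ (d :+ e) :- (b :+ (c :+ d)) :+ c) refl
                   (m ij) (m ji) (m jk) (m jl) (m lj) ⟩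
      (m ij + m ji) + (m jl + m lj) - (m ji + (m jk + m jl)) + m jk
        ≡⟨ cong₂ (λ x y → x - y + m jk) (cong₂ _+_ ij-zone jl-zone) j-star ⟩
      (ε + ε) - (ε + (ε + ε)) + m jk
        ≡⟨ cong ((ε + ε) - (ε + (ε + ε)) +_) jk≡0 ⟩
      ℚ.- ε
        ∎)

  X∖ij-supported : (m ij ≢ 0ℚ → m jk ≢ 0ℚ → m ki ≢ 0ℚ → ⊥) →
                   m ji ≢ 0ℚ × m jk ≢ 0ℚ × m kj ≢ 0ℚ × m ki ≢ 0ℚ × m ik ≢ 0ℚ
  X∖ij-supported ¬ijk = ji≢0 , jk≢0 , kj≢0 , ki≢0 , ik≢0
    where
    ij≡0 : m ij ≡ 0ℚ
    ij≡0 = excluded (λ ij≢0 _ → ¬ijk ij≢0 jk≢0 ki≢0) jk≢0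
    ji≢0 : m ji ≢ 0ℚ
    ji≢0 ji≡0 =
      pos-+-nonneg≢0 ε>0 ℚP.≤-refl (trans (ℚP.+-identityʳ ε) (trans (sym (complementˡ ij-zone ij≡0)) ji≡0))
    ik≢0 : m ik ≢ 0ℚ
    ik≢0 = pos-+-nonneg≢0 ε>0 (m≥0 li) ∘ trans (sym (begin
      m ik
        ≡⟨ solve 4 (λ a c f₁ f₂ → c := (a :+ (c :+ f₁)) :- (f₁ :+ f₂) :+ f₂ :- a) refl
                   (m ij) (m ik) (m il) (m li) ⟩
      (m ij + (m ik + m il)) - (m il + m li) + m li - m ij
        ≡⟨ cong₂ (λ x y → x - y + m li - m ij) i-star il-zone ⟩
      (ε + ε) - ε + m li - m ij
        ≡⟨ cong (λ x → (ε + ε) - ε + m li - x) ij≡0 ⟩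
      (ε + ε) - ε + m li - 0ℚ
        ≡⟨ solve 2 (λ e f → (e :+ e) :- e :+ f :- con 0ℚ := e :+ f) refl ε (m li) ⟩
      ε + m li
        ∎))
    kj≢0 : m kj ≢ 0ℚ
    kj≢0 = pos-+-nonneg≢0 ε>0 (m≥0 jl) ∘ trans (sym (begin
      m kj
        ≡⟨ solve 5 (λ a₁ a₂ b₁ b₂ d₁ → b₂ := (b₁ :+ b₂) :- (a₂ :+ (b₁ :+ d₁)) :+ (a₁ :+ a₂) :- a₁ :+ d₁) refl
                   (m ij) (m ji) (m jk) (m kj) (m jl) ⟩
      (m jk + m kj) - (m ji + (m jk + m jl)) + (m ij + m ji) - m ij + m jl
        ≡⟨ cong₂ (λ x y → x - y + (m ij + m ji) - m ij + m jl) jk-zone j-star ⟩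
      (ε + (ε + ε)) - (ε + (ε + ε)) + (m ij + m ji) - m ij + m jl
        ≡⟨ cong₂ (λ x y → (ε + (ε + ε)) - (ε + (ε + ε)) + x - y + m jl) ij-zone ij≡0 ⟩
      (ε + (ε + ε)) - (ε + (ε + ε)) + ε - 0ℚ + m jl
        ≡⟨ solve 2 (λ e d → (e :+ (e :+ e)) :- (e :+ (e :+ e)) :+ e :- con 0ℚ :+ d := e :+ d) refl ε (m jl) ⟩
      ε + m jl
        ∎))

  infeasible : (m ij ≢ 0ℚ → m jk ≢ 0ℚ → m ki ≢ 0ℚ → ⊥) →
               (m jk ≢ 0ℚ → m kl ≢ 0ℚ → m lj ≢ 0ℚ → ⊥) →
               (m ki ≢ 0ℚ → m il ≢ 0ℚ → m lk ≢ 0ℚ → ⊥) →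
               (m ji ≢ 0ℚ → m jk ≢ 0ℚ → m kj ≢ 0ℚ → m ki ≢ 0ℚ → m ik ≢ 0ℚ → m jl ≢ 0ℚ → m li ≢ 0ℚ → ⊥) →
               ⊥
  infeasible ¬ijk ¬jkl ¬kil ¬ijl =
    let ji≢0 , _ , kj≢0 , _ , ik≢0 = X∖ij-supported ¬ijk
    in cyclic-exclusion (ℚP.<⇒≢ ε>0 ∘ sym) jl-zone kl-zone il-zone l-star
         (¬ijl ji≢0 jk≢0 kj≢0 ki≢0 ik≢0) (¬jkl jk≢0) (¬kil ki≢0)

-- r, s, t, u, v, w are the superscripts of the proposition minus one.
module Tetrahedron (N : ℕ) {i j k l : Fin 4}
                   (i≢j : i ≢ j) (i≢k : i ≢ k) (i≢l : i ≢ l) (j≢k : j ≢ k) (j≢l : j ≢ l) (k≢l : k ≢ l)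
                   (r s t u v w : ℕ) (r<N : r ℕ.< N) (s<N : s ℕ.< N) (t<N : t ℕ.< N)
                   (u<N : u ℕ.< N) (v<N : v ℕ.< N) (w<N : w ℕ.< N) where

  open ΠProperties N

  vertex : Vertex → Fin 4
  vertex vᵢ = i
  vertex vⱼ = j
  vertex vₖ = k
  vertex vₗ = l

  vertex-injective : ∀ {a b} → vertex a ≡ vertex b → a ≡ b
  vertex-injective {vᵢ} {vᵢ} _ = refl
  vertex-injective {vᵢ} {vⱼ} i≡j = ⊥-elim (i≢j i≡j)
  vertex-injective {vᵢ} {vₖ} i≡k = ⊥-elim (i≢k i≡k)
  vertex-injective {vᵢ} {vₗ} i≡l = ⊥-elim (i≢l i≡l)
  vertex-injective {vⱼ} {vᵢ} j≡i = ⊥-elim (i≢j (sym j≡i))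
  vertex-injective {vⱼ} {vⱼ} _ = refl
  vertex-injective {vⱼ} {vₖ} j≡k = ⊥-elim (j≢k j≡k)
  vertex-injective {vⱼ} {vₗ} j≡l = ⊥-elim (j≢l j≡l)
  vertex-injective {vₖ} {vᵢ} k≡i = ⊥-elim (i≢k (sym k≡i))
  vertex-injective {vₖ} {vⱼ} k≡j = ⊥-elim (j≢k (sym k≡j))
  vertex-injective {vₖ} {vₖ} _ = refl
  vertex-injective {vₖ} {vₗ} k≡l = ⊥-elim (k≢l k≡l)
  vertex-injective {vₗ} {vᵢ} l≡i = ⊥-elim (i≢l (sym l≡i))
  vertex-injective {vₗ} {vⱼ} l≡j = ⊥-elim (j≢l (sym l≡j))
  vertex-injective {vₗ} {vₖ} l≡k = ⊥-elim (k≢l (sym l≡k))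
  vertex-injective {vₗ} {vₗ} _ = refl

  level : NamedPoint → ℤ
  level ij = ℤ.+ suc r
  level ji = -[1+ r ]
  level jk = ℤ.+ suc s
  level kj = -[1+ s ]
  level ki = ℤ.+ suc t
  level ik = -[1+ t ]
  level jl = ℤ.+ suc v
  level lj = -[1+ v ]
  level kl = ℤ.+ suc w
  level lk = -[1+ w ]
  level il = ℤ.+ suc u
  level li = -[1+ u ]

  level-bounded : ∀ p → ∣ level p ∣ ℕ.≤ N
  level-bounded ij = r<N
  level-bounded ji = r<N
  level-bounded jk = s<N
  level-bounded kj = s<N
  level-bounded ki = t<N
  level-bounded ik = t<N
  level-bounded jl = v<N
  level-bounded lj = v<N
  level-bounded kl = w<N
  level-bounded lk = w<N
  level-bounded il = u<N
  level-bounded li = u<N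

  lab : NamedPoint → Label
  lab p = vertex (src p) , vertex (dst p) , level p

  lab-injective : ∀ {p q} → lab p ≡ lab q → p ≡ q
  lab-injective eq = src-dst-injective (vertex-injective (cong proj₁ eq)) (vertex-injective (cong (proj₁ ∘ proj₂) eq))

  dualL-lab : ∀ p → dualL (lab p) ≡ lab (opposite p)
  dualL-lab ij = refl
  dualL-lab ji = refl
  dualL-lab jk = refl
  dualL-lab kj = refl
  dualL-lab ki = refl
  dualL-lab ik = refl
  dualL-lab jl = refl
  dualL-lab lj = refl
  dualL-lab kl = refl
  dualL-lab lk = refl
  dualL-lab il = refl
  dualL-lab li = refl

  -- Everything about `point` goes through `label-point`; unfolding the index arithmetic of Π instead
  -- makes type checking intractable.
  opaque
    point : NamedPoint → Fin (M N)
    point p = proj₁ (label-surjective {z = level p} (src≢dst p ∘ vertex-injective) (level-bounded p))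

    label-point : ∀ p → label N (point p) ≡ lab p
    label-point p = proj₂ (label-surjective {z = level p} (src≢dst p ∘ vertex-injective) (level-bounded p))

  point-injective : ∀ {p q} → point p ≡ point q → p ≡ q
  point-injective {p} {q} eq = lab-injective (trans (sym (label-point p)) (trans (cong (label N) eq) (label-point q)))

  does-lab-≟ : ∀ p q → does (lab p ≟L lab q) ≡ does (p ≟ₚ q)
  does-lab-≟ = does-≟-injective _≟ₚ_ _≟L_ lab-injective

  does-point-≟ : ∀ p q → does (point p Fin.≟ point q) ≡ does (p ≟ₚ q)
  does-point-≟ = does-≟-injective _≟ₚ_ Fin._≟_ point-injective

  posΠ-point-e : ∀ p a → posΠ N (point p) (inj₁ a) ≡ indicator (a ==F vertex (src p))
  posΠ-point-e p a = cong (λ x → indicator (a ==F proj₁ x)) (label-point p)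

  posΠ-point-vertex : ∀ p a → posΠ N (point p) (inj₁ (vertex a)) ≡ indicator (does (a ≟V src p))
  posΠ-point-vertex p a =
    trans (posΠ-point-e p (vertex a)) (cong indicator (does-≟-injective _≟V_ Fin._≟_ vertex-injective a (src p)))

  posΠ-point-f : ∀ p f → posΠ N (point p) (inj₂ f) ≡ indicator (sameF f (lab p))
  posΠ-point-f p f = cong (indicator ∘ sameF f) (label-point p)

  posΠ-point-zone : ∀ p q → posΠ N (point p) (inj₂ (lab q)) ≡ indicator (does (q ≟ₚ p) ∨ does (q ≟ₚ opposite p))
  posΠ-point-zone p q = begin
    posΠ N (point p) (inj₂ (lab q))
      ≡⟨ posΠ-point-f p (lab q) ⟩
    indicator (does (lab q ≟L lab p) ∨ does (lab q ≟L dualL (lab p)))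
      ≡⟨ cong (λ x → indicator (does (lab q ≟L lab p) ∨ does (lab q ≟L x))) (dualL-lab p) ⟩
    indicator (does (lab q ≟L lab p) ∨ does (lab q ≟L lab (opposite p)))
      ≡⟨ cong₂ (λ x y → indicator (x ∨ y)) (does-lab-≟ q p) (does-lab-≟ q (opposite p)) ⟩
    indicator (does (q ≟ₚ p) ∨ does (q ≟ₚ opposite p))
      ∎
    where open ≡-Reasoning

  posΠ-opposite-f : ∀ p f → posΠ N (point (opposite p)) (inj₂ f) ≡ posΠ N (point p) (inj₂ f)
  posΠ-opposite-f p f = begin
    posΠ N (point (opposite p)) (inj₂ f) ≡⟨ posΠ-point-f (opposite p) f ⟩
    indicator (sameF f (lab (opposite p))) ≡⟨ cong (indicator ∘ sameF f) (sym (dualL-lab p)) ⟩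
    indicator (sameF f (dualL (lab p)))    ≡⟨ cong indicator (sameF-dualL f (lab p)) ⟩
    indicator (sameF f (lab p))            ≡⟨ sym (posΠ-point-f p f) ⟩
    posΠ N (point p) (inj₂ f)              ∎
    where open ≡-Reasoning

  posΠ-point-unnamed : ∀ {x} → (∀ p → point p ≢ x) → ∀ p → posΠ N (point p) (inj₂ (label N x)) ≡ 0ℚ
  posΠ-point-unnamed {x} unnamed p = begin
    posΠ N (point p) (inj₂ (label N x))
      ≡⟨ posΠ-point-f p (label N x) ⟩
    indicator (does (label N x ≟L lab p) ∨ does (label N x ≟L dualL (lab p)))
      ≡⟨ cong (λ y → indicator (does (label N x ≟L lab p) ∨ does (label N x ≟L y))) (dualL-lab p) ⟩
    indicator (does (label N x ≟L lab p) ∨ does (label N x ≟L lab (opposite p)))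
      ≡⟨ cong₂ (λ b₁ b₂ → indicator (b₁ ∨ b₂)) (dec-false (label N x ≟L lab p) (label≢ p))
                                              (dec-false (label N x ≟L lab (opposite p)) (label≢ (opposite p))) ⟩
    0ℚ ∎
    where
    open ≡-Reasoning
    label≢ : ∀ p → label N x ≢ lab p
    label≢ p eq = unnamed p (label-injective (trans (label-point p) (sym eq)))

  triangle-dependence : ∀ {x₁ x₂ x₃} → dst x₁ ≡ src x₂ → dst x₂ ≡ src x₃ → dst x₃ ≡ src x₁ → ∀ c →
    posΠ N (point x₁) c + (posΠ N (point x₂) c + posΠ N (point x₃) c) ≡
    posΠ N (point (opposite x₁)) c + (posΠ N (point (opposite x₂)) c + posΠ N (point (opposite x₃)) c)
  triangle-dependence {x₁} {x₂} {x₃} _ _ _ (inj₂ f) =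
    sym (cong₂ _+_ (posΠ-opposite-f x₁ f) (cong₂ _+_ (posΠ-opposite-f x₂ f) (posΠ-opposite-f x₃ f)))
  triangle-dependence {x₁} {x₂} {x₃} x₁→x₂ x₂→x₃ x₃→x₁ (inj₁ a) = begin
    pos x₁ + (pos x₂ + pos x₃)
      ≡⟨ cong₂ _+_ (posΠ-point-e x₁ a) (cong₂ _+_ (posΠ-point-e x₂ a) (posΠ-point-e x₃ a)) ⟩
    at (src x₁) + (at (src x₂) + at (src x₃))
      ≡⟨ solve 3 (λ a b c → a :+ (b :+ c) := b :+ (c :+ a)) refl (at (src x₁)) (at (src x₂)) (at (src x₃)) ⟩
    at (src x₂) + (at (src x₃) + at (src x₁))
      ≡⟨ sym (cong₂ _+_ (cong at x₁→x₂) (cong₂ _+_ (cong at x₂→x₃) (cong at x₃→x₁))) ⟩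
    at (dst x₁) + (at (dst x₂) + at (dst x₃))
      ≡⟨ sym (cong₂ _+_ (at-opposite x₁) (cong₂ _+_ (at-opposite x₂) (at-opposite x₃))) ⟩
    pos (opposite x₁) + (pos (opposite x₂) + pos (opposite x₃))
      ∎
    where
    open ≡-Reasoning
    open +-*-Solver
    pos : NamedPoint → ℚ
    pos p = posΠ N (point p) (inj₁ a)
    at : Vertex → ℚ
    at b = indicator (a ==F vertex b)
    at-opposite : ∀ p → pos (opposite p) ≡ at (dst p)
    at-opposite p = trans (posΠ-point-e (opposite p) a) (cong at (src-opposite p))

  open import Data.List.Membership.DecPropositional _≟ₚ_ using () renaming (_∈?_ to _∈ₚ?_)

  -- pointSet ij jk ki and pointSet ji kj ik are definitionally `Xplus` and `Xminus` of X_ijk^rst, and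
  -- likewise for the circuits X_ijl, X_jkl and X_kil of the hypotheses.
  pointSet : NamedPoint → NamedPoint → NamedPoint → Subset (M N)
  pointSet a b c = points N (lab a ∷ lab b ∷ lab c ∷ [])

  point-∈-pointSet : ∀ {p} a b c → p ∈ₗ (a ∷ b ∷ c ∷ []) → point p ∈ pointSet a b c
  point-∈-pointSet {p} _ _ _ p∈ = ∈-points₃⁺ (subst (_∈ₗ _) (sym (label-point p)) (∈-map⁺ lab p∈))

  ∈-pointSet⁻ : ∀ a b c {z} → z ∈ pointSet a b c → ∃ λ p → p ∈ₗ (a ∷ b ∷ c ∷ []) × z ≡ point p
  ∈-pointSet⁻ _ _ _ z∈ =
    let p , p∈ , label-z≡lab-p = ∈-map⁻ lab (∈-points₃⁻ z∈)
    in p , p∈ , label-injective (trans label-z≡lab-p (sym (label-point p)))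

  point-∉-pointSet : ∀ {p} a b c → ¬ p ∈ₗ (a ∷ b ∷ c ∷ []) → point p ∉ pointSet a b c
  point-∉-pointSet a b c p∉ point-p∈ =
    let q , q∈ , point-p≡point-q = ∈-pointSet⁻ a b c point-p∈
    in p∉ (subst (_∈ₗ _) (sym (point-injective point-p≡point-q)) q∈)

  named? : ∀ x → (∃ λ p → point p ≡ x) ⊎ (∀ p → point p ≢ x)
  named? x = case Any.any? (λ p → point p Fin.≟ x) allPoints of λ
    { (yes named) → inj₁ (Any.satisfied named)
    ; (no ¬named) → inj₂ λ p point-p≡x →
                      ¬named (Any.map (λ p≡q → subst (λ q → point q ≡ x) p≡q point-p≡x) (∈-allPoints p))
    }

  combination-at : ∀ w q → combination point allPoints w (point q) ≡ w q
  combination-at w q = begin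
    sumL allPoints (λ p → w p * δ (point p) (point q))
      ≡⟨ sumL-cong allPoints (λ p → cong (λ b → w p * indicator b) (does-point-≟ p q)) ⟩
    sumL allPoints (λ p → w p * indicator (does (p ≟ₚ q)))
      ≡⟨ sumL-indicator allPoints (λ p → does (p ≟ₚ q)) w ⟩
    sumL (filterᵇ (λ p → does (p ≟ₚ q)) allPoints) w
      ≡⟨ cong (λ ps → sumL ps w) (filter-≟ₚ-allPoints q) ⟩
    w q + 0ℚ
      ≡⟨ ℚP.+-identityʳ (w q) ⟩
    w q ∎
    where open ≡-Reasoning

  open Π N
  open GeometryProperties (posΠ N)

  y : Coord → ℚ
  y c = sumL allPoints (λ p → ω p * posΠ N (point p) c)

  y∈convΠ : InConv ⊤ y
  y∈convΠ = InConv-combination point allPoints ω-nonneg sumL-ω (All.universal (λ _ → ∈⊤) allPoints)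

  module BarycentricCoordinates {σ} (y∈σ : InConv σ y) where

    μ : Fin (M N) → ℚ
    μ = proj₁ y∈σ

    m : NamedPoint → ℚ
    m p = μ (point p)

    private
      μ≥0      = proj₁ (proj₂ y∈σ)
      μ-supp   = proj₁ (proj₂ (proj₂ y∈σ))
      moments  = proj₂ (proj₂ (proj₂ (proj₂ y∈σ)))

    m≥0 : ∀ p → 0ℚ ℚ.≤ m p
    m≥0 p = μ≥0 (point p)

    m≢0⇒∈σ : ∀ {p} → m p ≢ 0ℚ → point p ∈ σ
    m≢0⇒∈σ {p} m≢0 = decidable-stable (point p ∈? σ) (m≢0 ∘ μ-supp (point p))

    -- x has coordinate 1 at its own f-coordinate, which no named point shares, so y vanishes there.
    μ-unnamed : ∀ {x} → (∀ p → point p ≢ x) → μ x ≡ 0ℚ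
    μ-unnamed {x} unnamed = begin
      μ x                    ≡⟨ sym (ℚP.*-identityʳ (μ x)) ⟩
      μ x * 1ℚ               ≡⟨ cong (μ x *_) (sym (posΠ-own-f x)) ⟩
      μ x * posΠ N x c       ≡⟨ sumℚ-nonneg-≡0 (λ x′ → *-nonneg (μ≥0 x′) (posΠ-nonneg x′ c))
                                                (trans (moments c) y-c≡0) x ⟩
      0ℚ                     ∎
      where
      open ≡-Reasoning
      c = inj₂ (label N x)
      y-c≡0 : y c ≡ 0ℚ
      y-c≡0 = sumL-zero (All.universal (λ p → trans (cong (ω p *_) (posΠ-point-unnamed unnamed p)) (ℚP.*-zeroʳ (ω p)))
                                       allPoints)

    μ≗combination : ∀ x → μ x ≡ combination point allPoints m x
    μ≗combination x = [ named , unnamed ]′ (named? x)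
      where
      named : (∃ λ p → point p ≡ x) → μ x ≡ combination point allPoints m x
      named (p , point-p≡x) = subst (λ x → μ x ≡ combination point allPoints m x) point-p≡x (sym (combination-at m p))
      unnamed : (∀ p → point p ≢ x) → μ x ≡ combination point allPoints m x
      unnamed point≢x = trans (μ-unnamed point≢x) (sym (combination-outside point m (All.universal point≢x allPoints)))

    same-moments : ∀ c → sumL allPoints (λ p → m p * posΠ N (point p) c) ≡ y c
    same-moments c = begin
      sumL allPoints (λ p → m p * posΠ N (point p) c)
        ≡⟨ sumℚ-combination point allPoints m (λ x → posΠ N x c) ⟨
      sumℚ (λ x → combination point allPoints m x * posΠ N x c)
        ≡⟨ sumℚ-cong (λ x → cong (_* posΠ N x c) (μ≗combination x)) ⟨
      sumℚ (λ x → μ x * posΠ N x c)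
        ≡⟨ moments c ⟩
      y c
        ∎
      where open ≡-Reasoning

    coordinate-sums : ∀ c (b : NamedPoint → Bool) → (∀ p → posΠ N (point p) c ≡ indicator (b p)) →
                      sumL (filterᵇ b allPoints) m ≡ sumL (filterᵇ b allPoints) ω
    coordinate-sums c b pos≡ = begin
      sumL (filterᵇ b allPoints) m                         ≡⟨ sumL-indicator allPoints b m ⟨
      sumL allPoints (λ p → m p * indicator (b p))         ≡⟨ sumL-cong allPoints (λ p → cong (m p *_) (pos≡ p)) ⟨
      sumL allPoints (λ p → m p * posΠ N (point p) c)      ≡⟨ same-moments c ⟩
      sumL allPoints (λ p → ω p * posΠ N (point p) c)      ≡⟨ sumL-cong allPoints (λ p → cong (ω p *_) (pos≡ p)) ⟩
      sumL allPoints (λ p → ω p * indicator (b p))         ≡⟨ sumL-indicator allPoints b ω ⟩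
      sumL (filterᵇ b allPoints) ω                         ∎
      where open ≡-Reasoning

    zone-sums : ∀ p → sumL (zone p) m ≡ sumL (zone p) ω
    zone-sums p =
      coordinate-sums (inj₂ (lab p)) (λ q → does (p ≟ₚ q) ∨ does (p ≟ₚ opposite q)) (λ q → posΠ-point-zone q p)

    star-sums : ∀ a → sumL (star a) m ≡ sumL (star a) ω
    star-sums a = coordinate-sums (inj₁ (vertex a)) (λ q → does (a ≟V src q)) (λ q → posΠ-point-vertex q a)

    private
      Xᵢⱼₖ = pointSet ij jk ki ∪ pointSet ji kj ik

    X∖ij⊆σ : m ji ≢ 0ℚ → m jk ≢ 0ℚ → m kj ≢ 0ℚ → m ki ≢ 0ℚ → m ik ≢ 0ℚ → Xᵢⱼₖ ─ ⁅ point ij ⁆ ⊆ σ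
    X∖ij⊆σ ji≢0 jk≢0 kj≢0 ki≢0 ik≢0 {z} z∈ =
      [ from-positive , from-negative ]′ (x∈p∪q⁻ (pointSet ij jk ki) (pointSet ji kj ik) (p─q⊆p Xᵢⱼₖ ⁅ point ij ⁆ z∈))
      where
      in-σ : ∀ {ps} → All (λ p → m p ≢ 0ℚ) ps → ∀ {p} → p ∈ₗ ps → z ≡ point p → z ∈ σ
      in-σ ps≢0 p∈ps z≡p = subst (_∈ σ) (sym z≡p) (m≢0⇒∈σ (All.lookup ps≢0 p∈ps))
      from-positive : z ∈ pointSet ij jk ki → z ∈ σ
      from-positive z∈⁺ = case ∈-pointSet⁻ ij jk ki z∈⁺ of λ
        { (p , here refl , z≡ij) → ⊥-elim (x∈p─q⇒x∉q z∈ (subst (_∈ ⁅ point ij ⁆) (sym z≡ij) (x∈⁅x⁆ (point ij))))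
        ; (p , there p∈ , z≡p)  → in-σ (jk≢0 ∷ ki≢0 ∷ []) p∈ z≡p
        }
      from-negative : z ∈ pointSet ji kj ik → z ∈ σ
      from-negative z∈⁻ = let p , p∈ , z≡p = ∈-pointSet⁻ ji kj ik z∈⁻ in in-σ (ji≢0 ∷ kj≢0 ∷ ik≢0 ∷ []) p∈ z≡p

    ∈σ∖X : ∀ p {p∉⁺ : False (p ∈ₚ? (ij ∷ jk ∷ ki ∷ []))} {p∉⁻ : False (p ∈ₚ? (ji ∷ kj ∷ ik ∷ []))} →
           m p ≢ 0ℚ → point p ∈ σ ─ Xᵢⱼₖ
    ∈σ∖X p {p∉⁺} {p∉⁻} m≢0 =
      x∈p∧x∉q⇒x∈p─q (m≢0⇒∈σ m≢0)
        ([ point-∉-pointSet ij jk ki (toWitnessFalse p∉⁺) , point-∉-pointSet ji kj ik (toWitnessFalse p∉⁻) ]′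
          ∘ x∈p∪q⁻ (pointSet ij jk ki) (pointSet ji kj ik))

  module _ {T : Subset (M N) → Set} (triangulation : IsTriangulation T) where

    open IsTriangulation triangulation using (covers)

    triangle-not-in-simplex :
      ∀ x₁ x₂ x₃ → dst x₁ ≡ src x₂ → dst x₂ ≡ src x₃ → dst x₃ ≡ src x₁ →
      {x₁∉⁻ : False (x₁ ∈ₚ? (opposite x₁ ∷ opposite x₂ ∷ opposite x₃ ∷ []))} →
      (∀ σ → InTXplus (pointSet x₁ x₂ x₃) (pointSet (opposite x₁) (opposite x₂) (opposite x₃)) σ → T σ) →
      ∀ {τ} → T τ → point x₁ ∈ τ → point x₂ ∈ τ → point x₃ ∈ τ → ⊥
    triangle-not-in-simplex x₁ x₂ x₃ x₁→x₂ x₂→x₃ x₃→x₁ {x₁∉⁻} 𝒯⁺⊆T Tτ x₁∈τ x₂∈τ x₃∈τ =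
      x₁∉Z (common-barycentre⇒∈ triangulation Tτ TZ x₁∈τ x₂∈τ x₃∈τ
             (point-∈-pointSet x̄₁ x̄₂ x̄₃ (here refl)) (point-∈-pointSet x̄₁ x̄₂ x̄₃ (there (here refl)))
             (point-∈-pointSet x̄₁ x̄₂ x̄₃ (there (there (here refl))))
             (triangle-dependence x₁→x₂ x₂→x₃ x₃→x₁))
      where
      x̄₁ = opposite x₁
      x̄₂ = opposite x₂
      x̄₃ = opposite x₃
      x₁∉Z = point-∉-pointSet x̄₁ x̄₂ x̄₃ (toWitnessFalse x₁∉⁻)
      TZ = negative-part-∈ (pointSet x₁ x₂ x₃) (pointSet x̄₁ x̄₂ x̄₃) triangulation 𝒯⁺⊆T
                           (point-∈-pointSet x₁ x₂ x₃ (here refl)) x₁∉Z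

    no-flip : (∀ σ → InTXplus (pointSet ij jl li) (pointSet ji lj il) σ → T σ) →
              (∀ σ → InTXplus (pointSet jk kl lj) (pointSet kj lk jl) σ → T σ) →
              (∀ σ → InTXplus (pointSet ki il lk) (pointSet ik li kl) σ → T σ) →
              ¬ HasFlip T (pointSet ij jk ki) (pointSet ji kj ik)
    no-flip 𝒯ᵢⱼₗ 𝒯ⱼₖₗ 𝒯ₖᵢₗ flip = contradiction (covers y y∈convΠ)
      where
      contradiction : (∃ λ σ → T σ × InConv σ y) → ⊥
      contradiction (σ , Tσ , y∈σ) = infeasible ¬ijk ¬jkl ¬kil ¬ijl
        where
        open BarycentricCoordinates y∈σ
        open Infeasibility m m≥0 zone-sums star-sums
        ¬ijk : m ij ≢ 0ℚ → m jk ≢ 0ℚ → m ki ≢ 0ℚ → ⊥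
        ¬ijk ij≢0 jk≢0 ki≢0 =
          triangle-not-in-simplex ij jk ki refl refl refl (proj₁ flip) Tσ (m≢0⇒∈σ ij≢0) (m≢0⇒∈σ jk≢0) (m≢0⇒∈σ ki≢0)
        ¬jkl : m jk ≢ 0ℚ → m kl ≢ 0ℚ → m lj ≢ 0ℚ → ⊥
        ¬jkl jk≢0 kl≢0 lj≢0 =
          triangle-not-in-simplex jk kl lj refl refl refl 𝒯ⱼₖₗ Tσ (m≢0⇒∈σ jk≢0) (m≢0⇒∈σ kl≢0) (m≢0⇒∈σ lj≢0)
        ¬kil : m ki ≢ 0ℚ → m il ≢ 0ℚ → m lk ≢ 0ℚ → ⊥
        ¬kil ki≢0 il≢0 lk≢0 =
          triangle-not-in-simplex ki il lk refl refl refl 𝒯ₖᵢₗ Tσ (m≢0⇒∈σ ki≢0) (m≢0⇒∈σ il≢0) (m≢0⇒∈σ lk≢0)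
        ¬ijl : m ji ≢ 0ℚ → m jk ≢ 0ℚ → m kj ≢ 0ℚ → m ki ≢ 0ℚ → m ik ≢ 0ℚ → m jl ≢ 0ℚ → m li ≢ 0ℚ → ⊥
        ¬ijl ji≢0 jk≢0 kj≢0 ki≢0 ik≢0 jl≢0 li≢0 =
          triangle-not-in-simplex ij jl li refl refl refl 𝒯ᵢⱼₗ T-flipped
            (x∈p∪q⁺ (inj₁ ij∈X∖jk)) (x∈p∪q⁺ (inj₂ (∈σ∖X jl jl≢0))) (x∈p∪q⁺ (inj₂ (∈σ∖X li li≢0)))
          where
          T-flipped = flip-exchange (pointSet ij jk ki) (pointSet ji kj ik) triangulation flip Tσ
                        (point-∈-pointSet ij jk ki (here refl)) (point-∈-pointSet ij jk ki (there (here refl)))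
                        (X∖ij⊆σ ji≢0 jk≢0 kj≢0 ki≢0 ik≢0)
          ij∈X∖jk : point ij ∈ (pointSet ij jk ki ∪ pointSet ji kj ik) ─ ⁅ point jk ⁆
          ij∈X∖jk = x∈p∧x∉q⇒x∈p─q (p⊆p∪q (pointSet ji kj ik) (point-∈-pointSet ij jk ki (here refl)))
                                   (λ ij∈⁅jk⁆ → case point-injective (x∈⁅y⁆⇒x≡y (point jk) ij∈⁅jk⁆) of λ ())

open import Data.Nat using (_≤_)
open import Data.Integer using (+_; -_)

proposition4p4 : (N : ℕ) → 1 ≤ N →
    (T : Subset (M N) → Set) → Π.IsTriangulation N T →
    (i j k l : Fin 4) →
    i ≢ j → i ≢ k → i ≢ l → j ≢ k → j ≢ l → k ≢ l →
    (r s t u v w : ℕ) →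
    1 ≤ r → r ≤ N → 1 ≤ s → s ≤ N → 1 ≤ t → t ≤ N →
    1 ≤ u → u ≤ N → 1 ≤ v → v ≤ N → 1 ≤ w → w ≤ N →
    TcircSub N T i j l (+ r) (+ v) (- (+ u)) →
    TcircSub N T j k l (+ s) (+ w) (- (+ v)) →
    TcircSub N T k i l (+ t) (+ u) (- (+ w)) →
    ¬ FlipOn N T i j k (+ r) (+ s) (+ t)
proposition4p4 N _ T triangulation i j k l i≢j i≢k i≢l j≢k j≢l k≢l
  (suc r) (suc s) (suc t) (suc u) (suc v) (suc w)
  (s≤s z≤n) r<N (s≤s z≤n) s<N (s≤s z≤n) t<N (s≤s z≤n) u<N (s≤s z≤n) v<N (s≤s z≤n) w<N =
  Tetrahedron.no-flip N i≢j i≢k i≢l j≢k j≢l k≢l r s t u v w r<N s<N t<N u<N v<N w<N triangulation
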